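{- Let $G=(V,E)$ be a connected graph and let $G^{+v}$ be obtained from $G$ by adding a new vertex $v$ together with some edges incident to $v$. Let $P$ be a path in the graph associahedron $\mathcal{A}(G)$ such that every maximal tubing $T$ in $P$ is a nested tubing whose kernel is adjacent to $v$ in $G^{+v}$. Let $P^{+v}$ be the sequence obtained by replacing each tubing $T$ of $P$ by $\{t\cup\{v\} : t\in T\}\cup\{\{v\}\}$ (equivalently, the nested tubing with associated permutation $\pi$ is replaced by the nested tubing with associated permutation $v,\pi(1),\ldots,\pi(n)$). Then $P^{+v}$ is a well-defined path in $\mathcal{A}(G^{+v})$.
   Context: For a connected graph $G=(V,E)$, a tube is a nonempty proper subset $t\subsetneq V$ with $G[t]$ connected; two distinct tubes are compatible if nested (one contains the other) or non-adjacent ($G[t_1\cup t_2]$ disconnected); a tubing is a set of pairwise compatible tubes. The graph associahedron $\mathcal{A}(G)$ has vertices the maximal tubings and edges between maximal tubings differing in exactly one tube. A nested tubing is a maximal tubing whose tubes are pairwise nested; it consists of tubes $t_1\subset\dots\subset t_{n-1}$ with $|t_k|=k$ ($n=|V|$), its kernel is the unique vertex of $t_1$, and its associated permutation $\pi$ satisfies $t_k=\{\pi(1),\ldots,\pi(k)\}$. -}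

module Defs where

open import Level using (Level)
open import Data.Nat using (ℕ; zero; suc; _≤_; _<_)
open import Data.Fin using (Fin; toℕ) renaming (zero to fzero; suc to fsuc)
open import Data.Fin.Subset using (Subset; _∈_; _⊆_; _∪_; ⁅_⁆; ⊤; Nonempty; inside)
open import Data.Vec using (_∷_)
open import Data.Product using (Σ; Σ-syntax; ∃; ∃-syntax; _×_; _,_)
open import Data.Sum using (_⊎_; inj₁; inj₂)
open import Data.Empty renaming (⊥ to Empty)
open import Data.List using (List; map)
open import Data.List.Relation.Unary.All using (All)
open import Data.List.Relation.Unary.Linked using (Linked)
open import Data.List.Relation.Unary.AllPairs using (AllPairs)
open import Relation.Nullary using (¬_)
open import Relation.Binary.PropositionalEquality using (_≡_; _≢_)
open import Function.Definitions using (Injective)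

record Graph (n : ℕ) : Set₁ where
  field
    Adj    : Fin n → Fin n → Set
    sym    : ∀ {x y} → Adj x y → Adj y x
    irrefl : ∀ {x} → ¬ Adj x x
open Graph public

module _ {n : ℕ} (G : Graph n) where

  data Walk (S : Subset n) : Fin n → Fin n → Set where
    here : ∀ {x} → x ∈ S → Walk S x x
    step : ∀ {x y z} → x ∈ S → Adj G x y → Walk S y z → Walk S x z

  Connected : Subset n → Set
  Connected S = ∀ x y → x ∈ S → y ∈ S → Walk S x y

  Tube : Subset n → Set
  Tube t = Nonempty t × t ≢ ⊤ × Connected t

  -- compatible: nested or non-adjacent (G[t₁ ∪ t₂] disconnected)
  Compatible : Subset n → Subset n → Set
  Compatible t₁ t₂ = (t₁ ⊆ t₂ ⊎ t₂ ⊆ t₁) ⊎ ¬ Connected (t₁ ∪ t₂)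

TubeSet : ℕ → Set₁
TubeSet n = Subset n → Set

module _ {n : ℕ} (G : Graph n) where

  IsTubing : TubeSet n → Set
  IsTubing T = (∀ t → T t → Tube G t)
             × (∀ t₁ t₂ → T t₁ → T t₂ → t₁ ≢ t₂ → Compatible G t₁ t₂)

  IsMaximalTubing : TubeSet n → Set₁
  IsMaximalTubing T = IsTubing T
    × (∀ (T′ : TubeSet n) → IsTubing T′ → (∀ t → T t → T′ t) → ∀ t → T′ t → T t)

  -- edge of the graph associahedron A(G): maximal tubings differing in exactly one tube
  Flip : TubeSet n → TubeSet n → Set₁
  Flip T T′ = IsMaximalTubing T × IsMaximalTubing T′
    × Σ[ t ∈ Subset n ] Σ[ t′ ∈ Subset n ]
        (T t × ¬ T′ t × T′ t′ × ¬ T t′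
         × (∀ s → s ≢ t → s ≢ t′ → (T s → T′ s) × (T′ s → T s)))

  SameTubing : TubeSet n → TubeSet n → Set
  SameTubing T T′ = ∀ s → (T s → T′ s) × (T′ s → T s)

  IsPath : List (TubeSet n) → Set₁
  IsPath P = All IsMaximalTubing P × Linked Flip P
           × AllPairs (λ T T′ → ¬ SameTubing T T′) P

  IsNestedTubing : TubeSet n → Set₁
  IsNestedTubing T = IsMaximalTubing T × (∀ t₁ t₂ → T t₁ → T t₂ → t₁ ⊆ t₂ ⊎ t₂ ⊆ t₁)

-- π is the associated permutation of T: the tubes of T are exactly
-- t_k = {π(1),…,π(k)} for 1 ≤ k ≤ n-1 (positions 0-based here)
IsAssociatedPermutation : {n : ℕ} → TubeSet n → (Fin n → Fin n) → Set
IsAssociatedPermutation {n} T π = Injective _≡_ _≡_ π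
  × (∀ s → (T s → Σ[ k ∈ ℕ ] (1 ≤ k × suc k ≤ n × IsPrefix s k))
         × (Σ[ k ∈ ℕ ] (1 ≤ k × suc k ≤ n × IsPrefix s k) → T s))
  where
  IsPrefix : Subset n → ℕ → Set
  IsPrefix s k = ∀ i → (i ∈ s → Σ[ j ∈ Fin n ] (toℕ j < k × π j ≡ i))
                     × (Σ[ j ∈ Fin n ] (toℕ j < k × π j ≡ i) → i ∈ s)

-- κ is the kernel of T: κ = π(1) for the associated permutation π
-- (for n ≥ 2 this is the unique vertex of t₁)
IsKernel : {n : ℕ} → TubeSet n → Fin n → Set
IsKernel {n} T κ = Σ[ π ∈ (Fin n → Fin n) ]
  (IsAssociatedPermutation T π × Σ[ j ∈ Fin n ] (toℕ j ≡ 0 × π j ≡ κ))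

-- G^{+v}: the new vertex v is fzero, old vertex i becomes fsuc i;
-- N is the set of old vertices joined to v.
module _ {n : ℕ} (G : Graph n) (N : Fin n → Set) where
  private
    A : Fin (suc n) → Fin (suc n) → Set
    A fzero    fzero    = Empty
    A fzero    (fsuc j) = N j
    A (fsuc i) fzero    = N i
    A (fsuc i) (fsuc j) = Adj G i j
    s : ∀ {x y} → A x y → A y x
    s {fzero}  {fzero}  ()
    s {fzero}  {fsuc j} p = p
    s {fsuc i} {fzero}  p = p
    s {fsuc i} {fsuc j} p = Graph.sym G p
    r : ∀ {x} → ¬ A x x
    r {fzero} ()
    r {fsuc i} p = irrefl G p

  addVertex : Graph (suc n)
  addVertex = record { Adj = A ; sym = λ {x} {y} → s {x} {y} ; irrefl = λ {x} → r {x} }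

-- T ↦ {t ∪ {v} : t ∈ T} ∪ {{v}}   (t ∪ {v} for t ⊆ old vertices is  inside ∷ t)
plusV : {n : ℕ} → TubeSet n → TubeSet (suc n)
plusV T u = (u ≡ ⁅ fzero ⁆) ⊎ Σ[ t ∈ Subset _ ] (T t × u ≡ inside ∷ t)

plusVPath : {n : ℕ} → List (TubeSet n) → List (TubeSet (suc n))
plusVPath = map plusV

{-# OPTIONS --safe #-}
-- Every tube of a nested tubing T contains its kernel κ, and κ is joined to v, so every t ∪ {v}
-- stays connected and {v} together with the t ∪ {v} is again a chain of tubes of G^{+v}.
-- It is maximal: a tube u compatible with it and avoiding v cannot contain κ (otherwise u ∪ {v}
-- would be connected), yet u would be a tube of G compatible with T, hence a tube of T by
-- maximality, hence contain κ. A compatible tube u through v meets every t ∪ {v}, so u ∖ {v} is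
-- nested with every prefix {π(1),…,π(k)} of the associated permutation, which forces it to be one
-- of them. Flips and distinctness transfer because T ↦ T^{+v} is injective and keeps the flipped tube.
module Submission where

open import Defs hiding (sym)
open import Level using (Level)
open import Function using (_∘_)
open import Data.Nat using (ℕ; zero; suc; _≤_; _<_; z≤n; s≤s; s≤s⁻¹; _<?_)
open import Data.Nat.Properties using (≤∧≢⇒<; ≮⇒≥; ≤-trans; ≤-refl; <-irrefl)
open import Data.Fin using (Fin; toℕ; inject; fromℕ<; punchOut) renaming (zero to fzero; suc to fsuc)
open import Data.Fin.Properties
  using (toℕ-injective; toℕ<n; toℕ-fromℕ<; toℕ-inject; punchOut-injective; any?; ¬∀⟶∃¬-smallest; injective⇒≤)
  renaming (_≟_ to _≟ᶠ_)
open import Data.Fin.Subset using (Subset; _∈_; _∉_; _⊆_; _∪_; ⁅_⁆; ⊤; ⊥; Nonempty; inside; outside)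
open import Data.Fin.Subset.Properties
  using (∈⊤; ∉⊥; ⊆⊤; ⊥⊆; _∈?_; p⊆p∪q; q⊆p∪q; x∈p∪q⁻; ∪-comm; ∪-identityʳ; drop-∷-⊆; s⊆s; ⊆-refl; ⊆-antisym;
         Empty-unique; nonempty?)
open import Data.Vec using (_∷_; tabulate; here; there)
open import Data.Vec.Properties using (∷-injectiveʳ; ≡-dec; []=⇒lookup; lookup⇒[]=; lookup∘tabulate)
open import Data.Bool.Properties using () renaming (_≟_ to _≟ᵇ_)
open import Data.Product using (Σ-syntax; ∃-syntax; _×_; _,_; proj₁; proj₂)
open import Data.Sum as Sum using (_⊎_; inj₁; inj₂)
open import Data.Empty using (⊥-elim) renaming (⊥ to Empty)
open import Data.List using (List; []; _∷_)
open import Data.List.Relation.Unary.All as All using (All; []; _∷_)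
import Data.List.Relation.Unary.All.Properties as All
open import Data.List.Relation.Unary.Linked as Linked using (Linked; []; [-]; _∷_)
import Data.List.Relation.Unary.Linked.Properties as Linked
open import Data.List.Relation.Unary.AllPairs as AllPairs using (AllPairs; []; _∷_)
import Data.List.Relation.Unary.AllPairs.Properties as AllPairs
open import Relation.Nullary using (¬_; yes; no; does)
open import Relation.Nullary.Decidable using (_×-dec_; dec-true)
open import Relation.Unary using (Pred; Decidable)
open import Relation.Binary using (Rel)
open import Relation.Binary.PropositionalEquality using (_≡_; _≢_; refl; sym; trans; cong; subst)
open import Function.Definitions using (Injective)

Nested : ∀ {n} → Subset n → Subset n → Set
Nested a b = a ⊆ b ⊎ b ⊆ a

module _ {n : ℕ} {H : Graph n} where

  Walk-source : ∀ {A x y} → Walk H A x y → x ∈ A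
  Walk-source (here x∈A)     = x∈A
  Walk-source (step x∈A _ _) = x∈A

  Walk-mono : ∀ {A B x y} → A ⊆ B → Walk H A x y → Walk H B x y
  Walk-mono A⊆B (here x∈A)      = here (A⊆B x∈A)
  Walk-mono A⊆B (step x∈A xy w) = step (A⊆B x∈A) xy (Walk-mono A⊆B w)

  _◅◅_ : ∀ {A x y z} → Walk H A x y → Walk H A y z → Walk H A x z
  here _          ◅◅ w′ = w′
  step x∈A xy w   ◅◅ w′ = step x∈A xy (w ◅◅ w′)

  Walk-∪ˡ : ∀ {A} B {x y} → Walk H A x y → Walk H (A ∪ B) x y
  Walk-∪ˡ B = Walk-mono (p⊆p∪q B)

  Walk-∪ʳ : ∀ A {B x y} → Walk H B x y → Walk H (A ∪ B) x y
  Walk-∪ʳ A {B} = Walk-mono (q⊆p∪q A B)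

  Connected-∪ : ∀ {A B x} → Connected H A → Connected H B → x ∈ A → x ∈ B → Connected H (A ∪ B)
  Connected-∪ {A} {B} {x} A-conn B-conn x∈A x∈B y z y∈ z∈ with x∈p∪q⁻ A B y∈ | x∈p∪q⁻ A B z∈
  ... | inj₁ y∈A | inj₁ z∈A = Walk-∪ˡ B (A-conn y z y∈A z∈A)
  ... | inj₂ y∈B | inj₂ z∈B = Walk-∪ʳ A (B-conn y z y∈B z∈B)
  ... | inj₁ y∈A | inj₂ z∈B = Walk-∪ˡ B (A-conn y x y∈A x∈A) ◅◅ Walk-∪ʳ A (B-conn x z x∈B z∈B)
  ... | inj₂ y∈B | inj₁ z∈A = Walk-∪ʳ A (B-conn y x y∈B x∈B) ◅◅ Walk-∪ˡ B (A-conn x z x∈A z∈A)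

  Compatible-sym : ∀ {a b} → Compatible H a b → Compatible H b a
  Compatible-sym {a} {b} = Sum.map Sum.swap (λ ¬ab-conn → ¬ab-conn ∘ subst (Connected H) (∪-comm b a))

  overlapping-compatible⇒nested : ∀ {a b x} → Connected H a → Connected H b → x ∈ a → x ∈ b
                                → Compatible H a b → Nested a b
  overlapping-compatible⇒nested _      _      _   _   (inj₁ nested)  = nested
  overlapping-compatible⇒nested a-conn b-conn x∈a x∈b (inj₂ ¬ab-conn) =
    ⊥-elim (¬ab-conn (Connected-∪ a-conn b-conn x∈a x∈b))

  IsTubing⇒Compatible : ∀ {T a b} → IsTubing H T → T a → T b → Compatible H a b
  IsTubing⇒Compatible {a = a} {b} (_ , compatible) Ta Tb with ≡-dec _≟ᵇ_ a b
  ... | yes refl = inj₁ (inj₁ ⊆-refl)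
  ... | no a≢b   = compatible a b Ta Tb a≢b

  maximal-absorbs : ∀ {T s} → IsMaximalTubing H T → Tube H s → (∀ t → T t → Compatible H t s) → T s
  maximal-absorbs {T} {s} ((tubes , compatible) , maximal) s-tube s-compatible =
    maximal T∪s (tubes′ , compatible′) (λ _ → inj₁) s (inj₂ refl)
    where
    T∪s : TubeSet n
    T∪s t = T t ⊎ t ≡ s
    tubes′ : ∀ t → T∪s t → Tube H t
    tubes′ t (inj₁ Tt)   = tubes t Tt
    tubes′ _ (inj₂ refl) = s-tube
    compatible′ : ∀ t₁ t₂ → T∪s t₁ → T∪s t₂ → t₁ ≢ t₂ → Compatible H t₁ t₂
    compatible′ t₁ t₂ (inj₁ T₁)   (inj₁ T₂)   = compatible t₁ t₂ T₁ T₂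
    compatible′ t₁ _  (inj₁ T₁)   (inj₂ refl) _ = s-compatible t₁ T₁
    compatible′ _  t₂ (inj₂ refl) (inj₁ T₂)   _ = Compatible-sym (s-compatible t₂ T₂)
    compatible′ _  _  (inj₂ refl) (inj₂ refl) s≢s = ⊥-elim (s≢s refl)

module _ {n : ℕ} {ℓ : Level} {P : Pred (Fin n) ℓ} where

  fromDecidable : Decidable P → Subset n
  fromDecidable P? = tabulate (does ∘ P?)

  ∈-fromDecidable⁺ : (P? : Decidable P) → ∀ {i} → P i → i ∈ fromDecidable P?
  ∈-fromDecidable⁺ P? {i} Pi = lookup⇒[]= i _ (trans (lookup∘tabulate (does ∘ P?) i) (dec-true (P? i) Pi))

  ∈-fromDecidable⁻ : (P? : Decidable P) → ∀ {i} → i ∈ fromDecidable P? → P i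
  ∈-fromDecidable⁻ P? {i} i∈ with P? i | trans (sym (lookup∘tabulate (does ∘ P?) i)) ([]=⇒lookup i∈)
  ... | yes Pi | _ = Pi
  ... | no _   | ()

injective⇒surjective : ∀ {n} {π : Fin n → Fin n} → Injective _≡_ _≡_ π → ∀ i → ∃[ j ] π j ≡ i
injective⇒surjective {zero}      _     ()
injective⇒surjective {suc n} {π} π-inj i with any? (λ j → π j ≟ᶠ i)
... | yes hit = hit
... | no miss = ⊥-elim (<-irrefl refl (injective⇒≤ punched-inj))
  where
  i≢π : ∀ j → i ≢ π j
  i≢π j i≡πj = miss (j , sym i≡πj)
  punched-inj : Injective _≡_ _≡_ (λ j → punchOut (i≢π j))
  punched-inj {a} {b} = π-inj ∘ punchOut-injective (i≢π a) (i≢π b)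

-- IsPrefix is the where-bound predicate of IsAssociatedPermutation, which Defs does not export;
-- prefix π k is the subset {π(0),…,π(k-1)} (0-based positions).
module _ {n : ℕ} (π : Fin n → Fin n) where

  ImageBelow : ℕ → Fin n → Set
  ImageBelow k i = ∃[ j ] (toℕ j < k × π j ≡ i)

  IsPrefix : Subset n → ℕ → Set
  IsPrefix s k = ∀ i → (i ∈ s → ImageBelow k i) × (ImageBelow k i → i ∈ s)

  ImageBelow? : ∀ k → Decidable (ImageBelow k)
  ImageBelow? k i = any? (λ j → (toℕ j <? k) ×-dec (π j ≟ᶠ i))

  prefix : ℕ → Subset n
  prefix k = fromDecidable (ImageBelow? k)

  prefix-IsPrefix : ∀ k → IsPrefix (prefix k) k
  prefix-IsPrefix k i = ∈-fromDecidable⁻ (ImageBelow? k) , ∈-fromDecidable⁺ (ImageBelow? k)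

module _ {n : ℕ} {π : Fin n → Fin n} (π-inj : Injective _≡_ _≡_ π) where

  first-position-outside : ∀ {s} → s ≢ ⊤ → ∃[ j ] (π j ∉ s × (∀ j′ → toℕ j′ < toℕ j → π j′ ∈ s))
  first-position-outside {s} s≢⊤ with ¬∀⟶∃¬-smallest n (λ j → π j ∈ s) (λ j → π j ∈? s) π-leaves-s
    where
    π-leaves-s : ¬ (∀ j → π j ∈ s)
    π-leaves-s all∈s = s≢⊤ (⊆-antisym ⊆⊤ λ {i} _ →
      let (j , πj≡i) = injective⇒surjective π-inj i in subst (_∈ s) πj≡i (all∈s j))
  ... | j , πj∉s , before∈s = j , πj∉s , λ j′ j′<j →
    subst (λ j″ → π j″ ∈ s) (toℕ-injective (trans (toℕ-inject _) (toℕ-fromℕ< j′<j))) (before∈s (fromℕ< j′<j))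

  nested-with-prefixes⇒prefix : ∀ {s} → Nonempty s → s ≢ ⊤
    → (∀ k → 1 ≤ k → suc k ≤ n → Nested s (prefix π k))
    → ∃[ k ] (1 ≤ k × suc k ≤ n × IsPrefix π s k)
  nested-with-prefixes⇒prefix {s} (x , x∈s) s≢⊤ nested = k , 1≤k , toℕ<n j* , s-prefix
    where
    miss : ∃[ j ] (π j ∉ s × (∀ j′ → toℕ j′ < toℕ j → π j′ ∈ s))
    miss = first-position-outside s≢⊤
    j* : Fin n
    j* = proj₁ miss
    k : ℕ
    k = toℕ j*
    πj*∉s : π j* ∉ s
    πj*∉s = proj₁ (proj₂ miss)

    -- For k+1 < n the prefix of length k+1 is nested with s and contains π j* ∉ s, so it
    -- contains s; for k+1 = n it contains every vertex.
    s⊆prefix-suc : ∀ i → i ∈ s → ImageBelow π (suc k) i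
    s⊆prefix-suc i i∈s with suc k <? n
    ... | yes k+1<n = Sum.[ (λ s⊆prefix → proj₁ (prefix-IsPrefix π (suc k) i) (s⊆prefix i∈s))
                          , (λ prefix⊆s → ⊥-elim (πj*∉s (prefix⊆s πj*∈prefix)))
                          ] (nested (suc k) (s≤s z≤n) k+1<n)
      where
      πj*∈prefix : π j* ∈ prefix π (suc k)
      πj*∈prefix = proj₂ (prefix-IsPrefix π (suc k) (π j*)) (j* , ≤-refl , refl)
    ... | no k+1≮n =
      let (j , πj≡i) = injective⇒surjective π-inj i in j , ≤-trans (toℕ<n j) (≮⇒≥ k+1≮n) , πj≡i

    s⊆prefix : ∀ i → i ∈ s → ImageBelow π k i
    s⊆prefix i i∈s with s⊆prefix-suc i i∈s
    ... | j , j≤k , πj≡i = j , ≤∧≢⇒< (s≤s⁻¹ j≤k) j≢j* , πj≡i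
      where
      j≢j* : toℕ j ≢ k
      j≢j* j≡j* = πj*∉s (subst (_∈ s) (trans (sym πj≡i) (cong π (toℕ-injective j≡j*))) i∈s)

    s-prefix : IsPrefix π s k
    s-prefix i = s⊆prefix i , λ (j , j<k , πj≡i) → subst (_∈ s) πj≡i (proj₂ (proj₂ miss) j j<k)

    1≤k : 1 ≤ k
    1≤k = let (_ , j<k , _) = s⊆prefix x x∈s in ≤-trans (s≤s z≤n) j<k

module _ {n : ℕ} {T : TubeSet n} where

  nested-with-tubes⇒tube : ∀ {π s} → IsAssociatedPermutation T π → Nonempty s → s ≢ ⊤
                         → (∀ t → T t → Nested s t) → T s
  nested-with-tubes⇒tube {π} (π-inj , tubes) s-nonempty s≢⊤ s-nested =
    proj₂ (tubes _) (nested-with-prefixes⇒prefix π-inj s-nonempty s≢⊤ λ k 1≤k k<n →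
      s-nested _ (proj₂ (tubes _) (k , 1≤k , k<n , prefix-IsPrefix π k)))

  kernel∈tube : ∀ {κ t} → IsKernel T κ → T t → κ ∈ t
  kernel∈tube {κ} {t} (π , (_ , tubes) , j₀ , j₀≡0 , πj₀≡κ) Tt with proj₁ (tubes t) Tt
  ... | k , 1≤k , _ , t-prefix = proj₂ (t-prefix κ) (j₀ , subst (_< k) (sym j₀≡0) 1≤k , πj₀≡κ)

plusV-inside⁻ : ∀ {n} {T : TubeSet n} {t} → Nonempty t → plusV T (inside ∷ t) → T t
plusV-inside⁻ (x , x∈t)   (inj₁ t≡⊥)            = ⊥-elim (∉⊥ (subst (x ∈_) (∷-injectiveʳ t≡⊥) x∈t))
plusV-inside⁻ {T = T} _ (inj₂ (r , Tr , t≡r)) = subst T (sym (∷-injectiveʳ t≡r)) Tr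

plusV-agrees-away : ∀ {n} {T T′ : TubeSet n} {t t′} → (∀ s → s ≢ t → s ≢ t′ → T s → T′ s)
                  → ∀ u → u ≢ inside ∷ t → u ≢ inside ∷ t′ → plusV T u → plusV T′ u
plusV-agrees-away _     _ _   _    (inj₁ u≡v)           = inj₁ u≡v
plusV-agrees-away agree _ u≢t u≢t′ (inj₂ (r , Tr , refl)) =
  inj₂ (r , agree r (u≢t ∘ cong (inside ∷_)) (u≢t′ ∘ cong (inside ∷_)) Tr , refl)

module AddVertex {n : ℕ} (G : Graph n) (N : Fin n → Set) where

  G⁺ : Graph (suc n)
  G⁺ = addVertex G N

  v∉outside∷ : ∀ {s : Subset n} → fzero ∉ outside ∷ s
  v∉outside∷ ()

  lift-walk : ∀ {s x y} → Walk G s x y → Walk G⁺ (inside ∷ s) (fsuc x) (fsuc y)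
  lift-walk (here x∈s)      = here (there x∈s)
  lift-walk (step x∈s xy w) = step (there x∈s) xy (lift-walk w)

  lower-walk : ∀ {s x y} → Walk G⁺ (outside ∷ s) (fsuc x) (fsuc y) → Walk G s x y
  lower-walk (here (there x∈s))                  = here x∈s
  lower-walk (step {y = fsuc _} (there x∈s) xy w) = step x∈s xy (lower-walk w)
  lower-walk (step {y = fzero}  _ _ w)           = ⊥-elim (v∉outside∷ (Walk-source w))

  Connected-inside∷ : ∀ {s κ} → Connected G s → κ ∈ s → N κ → Connected G⁺ (inside ∷ s)
  Connected-inside∷ _ _ _ fzero fzero _ _ = here here
  Connected-inside∷ {κ = κ} s-conn κ∈s vκ fzero (fsuc y) _ (there y∈s) =
    step here vκ (lift-walk (s-conn κ y κ∈s y∈s))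
  Connected-inside∷ {κ = κ} s-conn κ∈s vκ (fsuc x) fzero (there x∈s) _ =
    lift-walk (s-conn x κ x∈s κ∈s) ◅◅ step (there κ∈s) vκ (here here)
  Connected-inside∷ s-conn _ _ (fsuc x) (fsuc y) (there x∈s) (there y∈s) =
    lift-walk (s-conn x y x∈s y∈s)

  Connected-outside∷⁻ : ∀ {s} → Connected G⁺ (outside ∷ s) → Connected G s
  Connected-outside∷⁻ conn x y x∈s y∈s = lower-walk (conn (fsuc x) (fsuc y) (there x∈s) (there y∈s))

  Connected-⁅v⁆ : Connected G⁺ ⁅ fzero ⁆
  Connected-⁅v⁆ fzero    fzero    _           _           = here here
  Connected-⁅v⁆ (fsuc _) _        (there x∈⊥) _           = ⊥-elim (∉⊥ x∈⊥)
  Connected-⁅v⁆ fzero    (fsuc _) _           (there y∈⊥) = ⊥-elim (∉⊥ y∈⊥)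

  Compatible-lower : ∀ {t s κ} → κ ∈ t → N κ → Compatible G⁺ (inside ∷ t) (outside ∷ s) → Compatible G t s
  Compatible-lower _ _ (inj₁ (inj₁ t⊆s)) = ⊥-elim (v∉outside∷ (t⊆s here))
  Compatible-lower _ _ (inj₁ (inj₂ s⊆t)) = inj₁ (inj₂ (drop-∷-⊆ s⊆t))
  Compatible-lower {s = s} κ∈t vκ (inj₂ ¬conn) =
    inj₂ (λ ts-conn → ¬conn (Connected-inside∷ ts-conn (p⊆p∪q s κ∈t) vκ))

  compatible-with-⁅v⁆⇒∉ : ∀ {s κ} → Nonempty s → Connected G s → N κ
                         → Compatible G⁺ (outside ∷ s) ⁅ fzero ⁆ → κ ∉ s
  compatible-with-⁅v⁆⇒∉ (x , x∈s) _ _ (inj₁ (inj₁ u⊆⁅v⁆)) _ = ∉⊥ (drop-∷-⊆ u⊆⁅v⁆ x∈s)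
  compatible-with-⁅v⁆⇒∉ _ _ _ (inj₁ (inj₂ ⁅v⁆⊆u)) _ = v∉outside∷ (⁅v⁆⊆u here)
  compatible-with-⁅v⁆⇒∉ {s} _ s-conn vκ (inj₂ ¬conn) κ∈s =
    ¬conn (Connected-inside∷ (subst (Connected G) (sym (∪-identityʳ s)) s-conn) (p⊆p∪q ⊥ κ∈s) vκ)

  module _ {T : TubeSet n} {κ : Fin n} (T-max : IsMaximalTubing G T)
           (T-nested : ∀ t₁ t₂ → T t₁ → T t₂ → Nested t₁ t₂) (κ-kernel : IsKernel T κ) (vκ : N κ) where

    plusV-tube : ∀ {u} → plusV T u → Tube G⁺ u
    plusV-tube (inj₁ refl) =
      (fzero , here) , (λ ⁅v⁆≡⊤ → ∉⊥ (subst (κ ∈_) (sym (∷-injectiveʳ ⁅v⁆≡⊤)) ∈⊤)) , Connected-⁅v⁆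
    plusV-tube (inj₂ (t , Tt , refl)) with proj₁ (proj₁ T-max) t Tt
    ... | (x , x∈t) , t≢⊤ , t-conn =
      (fsuc x , there x∈t) , t≢⊤ ∘ ∷-injectiveʳ , Connected-inside∷ t-conn (kernel∈tube κ-kernel Tt) vκ

    plusV-nested : ∀ {u w} → plusV T u → plusV T w → Nested u w
    plusV-nested (inj₁ refl)            (inj₁ refl)            = inj₁ ⊆-refl
    plusV-nested (inj₁ refl)            (inj₂ (_ , _ , refl))  = inj₁ (s⊆s ⊥⊆)
    plusV-nested (inj₂ (_ , _ , refl))  (inj₁ refl)            = inj₂ (s⊆s ⊥⊆)
    plusV-nested (inj₂ (t , Tt , refl)) (inj₂ (r , Tr , refl)) = Sum.map s⊆s s⊆s (T-nested t r Tt Tr)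

    plusV-tubing : IsTubing G⁺ (plusV T)
    plusV-tubing = (λ _ → plusV-tube) , λ _ _ Tu Tw _ → inj₁ (plusV-nested Tu Tw)

    no-compatible-tube-avoids-v : ∀ {s} → Tube G⁺ (outside ∷ s) → Compatible G⁺ (outside ∷ s) ⁅ fzero ⁆
                                → (∀ t → T t → Compatible G⁺ (inside ∷ t) (outside ∷ s)) → Empty
    no-compatible-tube-avoids-v {s} ((fsuc x , there x∈s) , _ , u-conn) with-v with-T =
      κ∉s (kernel∈tube κ-kernel (maximal-absorbs T-max s-tube λ t Tt →
        Compatible-lower (kernel∈tube κ-kernel Tt) vκ (with-T t Tt)))
      where
      s-conn : Connected G s
      s-conn = Connected-outside∷⁻ u-conn
      κ∉s : κ ∉ s
      κ∉s = compatible-with-⁅v⁆⇒∉ (x , x∈s) s-conn vκ with-v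
      s-tube : Tube G s
      s-tube = (x , x∈s) , (λ s≡⊤ → κ∉s (subst (κ ∈_) (sym s≡⊤) ∈⊤)) , s-conn

    compatible-tube-through-v∈plusV : ∀ {s} → Tube G⁺ (inside ∷ s)
      → (∀ t → T t → Compatible G⁺ (inside ∷ s) (inside ∷ t)) → plusV T (inside ∷ s)
    compatible-tube-through-v∈plusV {s} (_ , u≢⊤ , u-conn) with-T with nonempty? s
    ... | no s-empty = inj₁ (cong (inside ∷_) (Empty-unique s-empty))
    ... | yes s-nonempty =
      inj₂ (s , nested-with-tubes⇒tube (proj₁ (proj₂ κ-kernel)) s-nonempty (u≢⊤ ∘ cong (inside ∷_)) s-nested , refl)
      where
      s-nested : ∀ t → T t → Nested s t
      s-nested t Tt = Sum.map drop-∷-⊆ drop-∷-⊆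
        (overlapping-compatible⇒nested u-conn (proj₂ (proj₂ (plusV-tube (inj₂ (t , Tt , refl))))) here here
          (with-T t Tt))

    plusV-absorbs : ∀ {T′} → IsTubing G⁺ T′ → (∀ u → plusV T u → T′ u) → ∀ u → T′ u → plusV T u
    plusV-absorbs T′-tubing ⊇plusV (outside ∷ s) T′u =
      ⊥-elim (no-compatible-tube-avoids-v (proj₁ T′-tubing _ T′u)
        (IsTubing⇒Compatible T′-tubing T′u (⊇plusV _ (inj₁ refl)))
        λ t Tt → IsTubing⇒Compatible T′-tubing (⊇plusV _ (inj₂ (t , Tt , refl))) T′u)
    plusV-absorbs T′-tubing ⊇plusV (inside ∷ s) T′u =
      compatible-tube-through-v∈plusV (proj₁ T′-tubing _ T′u)
        λ t Tt → IsTubing⇒Compatible T′-tubing T′u (⊇plusV _ (inj₂ (t , Tt , refl)))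

  LiftableTubing : TubeSet n → Set₁
  LiftableTubing T = IsNestedTubing G T × Σ[ κ ∈ Fin n ] (IsKernel T κ × Adj G⁺ fzero (fsuc κ))

  plusV-maximal : ∀ {T} → LiftableTubing T → IsMaximalTubing G⁺ (plusV T)
  plusV-maximal ((T-max , T-nested) , _ , κ-kernel , vκ) =
    plusV-tubing T-max T-nested κ-kernel vκ , λ _ → plusV-absorbs T-max T-nested κ-kernel vκ

  plusV-Flip : ∀ {T T′} → Flip G T T′ → IsMaximalTubing G⁺ (plusV T) → IsMaximalTubing G⁺ (plusV T′)
             → Flip G⁺ (plusV T) (plusV T′)
  plusV-Flip (((tubes , _) , _) , ((tubes′ , _) , _) , t , t′ , Tt , ¬T′t , T′t′ , ¬Tt′ , agree) T⁺-max T′⁺-max =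
    T⁺-max , T′⁺-max , inside ∷ t , inside ∷ t′ ,
    inj₂ (t , Tt , refl) , ¬T′t ∘ plusV-inside⁻ (proj₁ (tubes t Tt)) ,
    inj₂ (t′ , T′t′ , refl) , ¬Tt′ ∘ plusV-inside⁻ (proj₁ (tubes′ t′ T′t′)) ,
    λ u u≢t u≢t′ → plusV-agrees-away (λ s s≢t s≢t′ → proj₁ (agree s s≢t s≢t′)) u u≢t u≢t′
                 , plusV-agrees-away (λ s s≢t s≢t′ → proj₂ (agree s s≢t s≢t′)) u u≢t u≢t′

  plusV-distinct : ∀ {T T′} → IsTubing G T → IsTubing G T′ → ¬ SameTubing G T T′
                 → ¬ SameTubing G⁺ (plusV T) (plusV T′)
  plusV-distinct (tubes , _) (tubes′ , _) T≠T′ same = T≠T′ λ s →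
    (λ Ts → plusV-inside⁻ (proj₁ (tubes s Ts)) (proj₁ (same _) (inj₂ (s , Ts , refl)))) ,
    (λ T′s → plusV-inside⁻ (proj₁ (tubes′ s T′s)) (proj₂ (same _) (inj₂ (s , T′s , refl))))

module _ {a p r} {A : Set a} {P : Pred A p} {R : Rel A r} where

  Linked-withAll : ∀ {xs} → All P xs → Linked R xs → Linked (λ x y → P x × P y × R x y) xs
  Linked-withAll []               []          = []
  Linked-withAll (_ ∷ [])         [-]         = [-]
  Linked-withAll (px ∷ py ∷ pxs) (rxy ∷ rxs) = (px , py , rxy) ∷ Linked-withAll (py ∷ pxs) rxs

  AllPairs-withAll : ∀ {xs} → All P xs → AllPairs R xs → AllPairs (λ x y → P x × P y × R x y) xs
  AllPairs-withAll []         []           = []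
  AllPairs-withAll (px ∷ pxs) (rxs ∷ rxss) =
    All.zipWith (λ (py , rxy) → px , py , rxy) (pxs , rxs) ∷ AllPairs-withAll pxs rxss

lemma5p2 : {n : ℕ} (G : Graph n) → Connected G ⊤ → (N : Fin n → Set)
    → (P : List (TubeSet n)) → IsPath G P
    → All (λ T → IsNestedTubing G T
                × Σ[ κ ∈ Fin n ] (IsKernel T κ × Adj (addVertex G N) fzero (fsuc κ))) P
    → IsPath (addVertex G N) (plusVPath P)
lemma5p2 G _ N P (maximal , flips , distinct) liftable =
  All.map⁺ (All.map plusV-maximal liftable) ,
  Linked.map⁺ (Linked.map (λ (T , T′ , T→T′) → plusV-Flip T→T′ (plusV-maximal T) (plusV-maximal T′))
                          (Linked-withAll liftable flips)) ,
  AllPairs.map⁺ (AllPairs.map (λ (T-max , T′-max , T≠T′) → plusV-distinct (proj₁ T-max) (proj₁ T′-max) T≠T′)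
                              (AllPairs-withAll maximal distinct))
  where open AddVertex G N
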